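{- Let $p,q > 3$ be two distinct prime numbers. If $x, a_1, a_2, a_3 \in \mathbb{Z}$ satisfy $\gcd(a_i, pq) = 1$ for $i = 1,2,3$, then there is a (possibly empty) subset $I \subseteq \{1,2,3\}$ such that $x + \sum_{i\in I} a_i$ is relatively prime to $pq$. -}

module Defs where

open import Data.Bool using (Bool; true; false)
open import Data.Fin using (Fin)
open import Data.Fin.Subset using (Subset)
open import Data.Integer using (ℤ; _+_; 0ℤ)
open import Data.Vec using (Vec; []; _∷_)

subsetSum : ∀ {n} → Subset n → Vec ℤ n → ℤ
subsetSum [] [] = 0ℤ
subsetSum (true ∷ I) (a ∷ as) = a + subsetSum I as
subsetSum (false ∷ I) (a ∷ as) = subsetSum I as

{-# OPTIONS --safe #-}
module Submission where

open import Defs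
open import Data.Nat using (ℕ; _>_)
open import Data.Nat.Primality using (Prime)
open import Data.Integer using (ℤ; _+_; _*_; +_)
open import Data.Integer.GCD using (gcd)
open import Data.Fin.Subset using (Subset)
open import Data.Vec using (Vec; _∷_; [])
open import Data.Product using (∃)
open import Relation.Binary.PropositionalEquality using (_≡_; _≢_)

open import Level using (Level)
open import Data.Bool using (true; false)
open import Data.Fin using (Fin; zero; suc)
open import Data.Fin.Subset using (⁅_⁆; _∪_; _∉_)
open import Data.Fin.Subset.Properties using (∪-identityʳ; anySubset?)
open import Data.Product using (_×_; _,_)
open import Data.Sum as Sum using (_⊎_; inj₁; inj₂; [_,_]; swap)
open import Data.Vec using (lookup; here; there)
open import Function using (_∘_; id)
open import Relation.Nullary using (¬_; yes; no; contradiction)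
open import Relation.Nullary.Decidable using (decidable-stable)
open import Relation.Binary.PropositionalEquality using (refl; cong; subst; sym; trans; module ≡-Reasoning)
import Data.Nat as ℕ
import Data.Nat.Divisibility as ℕ
open import Data.Nat.Properties using (<⇒≤)
open import Data.Nat.Coprimality using (Coprime; coprime-divisor; coprime⇒gcd≡1; gcd≡1⇒coprime; prime⇒coprime)
open import Data.Nat.Divisibility using (∣-trans; m∣m*n)
open import Data.Nat.Primality using (prime⇒irreducible; ¬prime[1])
open import Data.Integer using (_-_; ∣_∣; 0ℤ)
open import Data.Integer.Properties using (abs-*; +-injective; +-assoc; +-comm; *-comm; _≟_)
import Data.Integer.Coprimality as ℤ
open import Data.Integer.Divisibility.Signed
  using (_∣_; _∣?_; ∣ᵤ⇒∣; ∣⇒∣ᵤ; ∣m+n∣m⇒∣n; ∣m∣n⇒∣m+n; ∣m∣n⇒∣m-n)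
open import Data.Integer.Tactic.RingSolver using (solve-∀)

-- Regard the subsets I ⊆ {1,2,3} as the vertices of a cube, put s_I = x + Σ_{i ∈ I} aᵢ,
-- and for a prime r let D_r = {I | r ∣ s_I}. Since r ∤ aᵢ, no edge of the cube lies in
-- D_r; and since the alternating sum s₁₂ + s₁₃ − s₂₃ − s∅ over the even vertices is 2a₁,
-- an odd r cannot divide all four of them. Now if D_p ∪ D_q were the whole cube
-- with, say, ∅ ∈ D_p, then {1}, {2} ∈ D_q and hence {1,2}, {1,3}, {2,3} ∈ D_p, so D_p
-- would contain every even vertex. Everything being decidable, a vertex outside
-- D_p ∪ D_q can then be found by search.

private
  variable
    ℓ : Level
    m n o p q : ℕ
    a : ℤ

prime∤⇒coprime : Prime p → ¬ p ℕ.∣ m → Coprime m p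
prime∤⇒coprime p-prime p∤m (d∣m , d∣p) with prime⇒irreducible p-prime d∣p
... | inj₁ d≡1 = d≡1
... | inj₂ refl = contradiction d∣m p∤m

coprime-*ʳ : Coprime m n → Coprime m o → Coprime m (n ℕ.* o)
coprime-*ʳ {n = n} m⊥n m⊥o {d} (d∣m , d∣n*o) = m⊥o (d∣m , coprime-divisor d⊥n d∣n*o)
  where
  d⊥n : Coprime d n
  d⊥n (e∣d , e∣n) = m⊥n (∣-trans e∣d d∣m , e∣n)

gcd[i,p*q]≡1⇒p∤i : Prime p → gcd a (+ p * + q) ≡ + 1 → ¬ + p ∣ a
gcd[i,p*q]≡1⇒p∤i {p} {a} {q} p-prime gcd≡1 p∣a =
  ¬prime[1] (subst Prime (a⊥pq (∣⇒∣ᵤ p∣a , p∣pq)) p-prime)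
  where
  a⊥pq : Coprime ∣ a ∣ ∣ + p * + q ∣
  a⊥pq = gcd≡1⇒coprime (+-injective gcd≡1)
  p∣pq : p ℕ.∣ ∣ + p * + q ∣
  p∣pq = subst (p ℕ.∣_) (sym (abs-* (+ p) (+ q))) (m∣m*n q)

gcd[i,p*q]≡1⇒q∤i : Prime q → gcd a (+ p * + q) ≡ + 1 → ¬ + q ∣ a
gcd[i,p*q]≡1⇒q∤i {q} {a} {p} q-prime gcd≡1 =
  gcd[i,p*q]≡1⇒p∤i q-prime (subst (λ m → gcd a m ≡ + 1) (*-comm (+ p) (+ q)) gcd≡1)

gcd[i,p*q]≢1⇒p∣i⊎q∣i : Prime p → Prime q → gcd a (+ p * + q) ≢ + 1 → (+ p ∣ a) ⊎ (+ q ∣ a)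
gcd[i,p*q]≢1⇒p∣i⊎q∣i {p} {q} {a} p-prime q-prime gcd≢1 with + p ∣? a | + q ∣? a
... | yes p∣a | _ = inj₁ p∣a
... | no _ | yes q∣a = inj₂ q∣a
... | no p∤a | no q∤a = contradiction gcd≡1 gcd≢1
  where
  a⊥pq : Coprime ∣ a ∣ (p ℕ.* q)
  a⊥pq = coprime-*ʳ (prime∤⇒coprime p-prime (p∤a ∘ ∣ᵤ⇒∣)) (prime∤⇒coprime q-prime (q∤a ∘ ∣ᵤ⇒∣))
  gcd≡1 : gcd a (+ p * + q) ≡ + 1
  gcd≡1 = cong +_ (coprime⇒gcd≡1 (subst (Coprime ∣ a ∣) (sym (abs-* (+ p) (+ q))) a⊥pq))

odd-prime∣2*i⇒∣i : Prime p → p > 2 → + p ∣ + 2 * a → + p ∣ a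
odd-prime∣2*i⇒∣i {p} {a} p-prime p>2 p∣2a =
  ∣ᵤ⇒∣ (ℤ.coprime-divisor (+ p) (+ 2) a (prime⇒coprime p-prime p>2) (∣⇒∣ᵤ p∣2a))

subsetSum-∪-⁅⁆ : (I : Subset n) (x : Vec ℤ n) {i : Fin n} → i ∉ I →
                 subsetSum (I ∪ ⁅ i ⁆) x ≡ subsetSum I x + lookup x i
subsetSum-∪-⁅⁆ (false ∷ I) (x ∷ xs) {zero} _ =
  begin
    x + subsetSum (I ∪ _) xs  ≡⟨ cong (λ J → x + subsetSum J xs) (∪-identityʳ I) ⟩
    x + subsetSum I xs        ≡⟨ +-comm x _ ⟩
    subsetSum I xs + x        ∎
  where open ≡-Reasoning
subsetSum-∪-⁅⁆ (true ∷ I) (x ∷ xs) {zero} zero∉I = contradiction here zero∉I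
subsetSum-∪-⁅⁆ (false ∷ I) (x ∷ xs) {suc i} i∉I = subsetSum-∪-⁅⁆ I xs (i∉I ∘ there)
subsetSum-∪-⁅⁆ (true ∷ I) (x ∷ xs) {suc i} i∉I =
  begin
    x + subsetSum (I ∪ ⁅ i ⁆) xs         ≡⟨ cong (λ s → x + s) (subsetSum-∪-⁅⁆ I xs (i∉I ∘ there)) ⟩
    x + (subsetSum I xs + lookup xs i)   ≡⟨ sym (+-assoc x _ _) ⟩
    x + subsetSum I xs + lookup xs i     ∎
  where open ≡-Reasoning

Independent : (Subset n → Set ℓ) → Set ℓ
Independent P = ∀ I i → i ∉ I → P I → ¬ P (I ∪ ⁅ i ⁆)

divisibleSubsetSums-independent : (d x : ℤ) (as : Vec ℤ n) → (∀ i → ¬ d ∣ lookup as i) →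
                                  Independent (λ I → d ∣ x + subsetSum I as)
divisibleSubsetSums-independent d x as d∤as I i i∉I d∣s d∣s′ =
  d∤as i (∣m+n∣m⇒∣n (subst (d ∣_) s′≡s+aᵢ d∣s′) d∣s)
  where
  s′≡s+aᵢ : x + subsetSum (I ∪ ⁅ i ⁆) as ≡ x + subsetSum I as + lookup as i
  s′≡s+aᵢ = trans (cong (λ s → x + s) (subsetSum-∪-⁅⁆ I as i∉I)) (sym (+-assoc x _ _))

OnEvenVertices : (Subset 3 → Set ℓ) → Set ℓ
OnEvenVertices P = P (false ∷ false ∷ false ∷ []) × P (true ∷ true ∷ false ∷ [])
                 × P (true ∷ false ∷ true ∷ []) × P (false ∷ true ∷ true ∷ [])

module _ {P Q : Subset 3 → Set ℓ} (P-ind : Independent P) (Q-ind : Independent Q)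
         (cover : ∀ I → P I ⊎ Q I) where

  private
    ¬P⇒Q : ∀ {I} → ¬ P I → Q I
    ¬P⇒Q {I} ¬PI = [ (λ PI → contradiction PI ¬PI) , id ] (cover I)

    ¬Q⇒P : ∀ {I} → ¬ Q I → P I
    ¬Q⇒P {I} ¬QI = [ id , (λ QI → contradiction QI ¬QI) ] (cover I)

  independentCover-∅⇒onEvenVertices : P (false ∷ false ∷ false ∷ []) → OnEvenVertices P
  independentCover-∅⇒onEvenVertices P∅ = P∅ , P₁₂ , P₁₃ , P₂₃
    where
    Q₁ : Q (true ∷ false ∷ false ∷ [])
    Q₁ = ¬P⇒Q (P-ind _ zero (λ ()) P∅)
    Q₂ : Q (false ∷ true ∷ false ∷ [])
    Q₂ = ¬P⇒Q (P-ind _ (suc zero) (λ { (there ()) }) P∅)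
    P₁₂ : P (true ∷ true ∷ false ∷ [])
    P₁₂ = ¬Q⇒P (Q-ind _ (suc zero) (λ { (there ()) }) Q₁)
    P₁₃ : P (true ∷ false ∷ true ∷ [])
    P₁₃ = ¬Q⇒P (Q-ind _ (suc (suc zero)) (λ { (there (there ())) }) Q₁)
    P₂₃ : P (false ∷ true ∷ true ∷ [])
    P₂₃ = ¬Q⇒P (Q-ind _ (suc (suc zero)) (λ { (there (there ())) }) Q₂)

independentCover⇒onEvenVertices : {P Q : Subset 3 → Set ℓ} → Independent P → Independent Q →
                                  (∀ I → P I ⊎ Q I) → OnEvenVertices P ⊎ OnEvenVertices Q
independentCover⇒onEvenVertices P-ind Q-ind cover =
  Sum.map (independentCover-∅⇒onEvenVertices P-ind Q-ind cover)
          (independentCover-∅⇒onEvenVertices Q-ind P-ind (swap ∘ cover))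
          (cover (false ∷ false ∷ false ∷ []))

divisibleOnEvenVertices⇒∣2* : (d x a₁ a₂ a₃ : ℤ) →
  OnEvenVertices (λ I → d ∣ x + subsetSum I (a₁ ∷ a₂ ∷ a₃ ∷ [])) → d ∣ + 2 * a₁
divisibleOnEvenVertices⇒∣2* d x a₁ a₂ a₃ (d∣s∅ , d∣s₁₂ , d∣s₁₃ , d∣s₂₃) =
  subst (d ∣_) (alternatingSum x a₁ a₂ a₃)
        (∣m∣n⇒∣m-n (∣m∣n⇒∣m+n d∣s₁₂ d∣s₁₃) (∣m∣n⇒∣m+n d∣s₂₃ d∣s∅))
  where
  alternatingSum : ∀ x a₁ a₂ a₃ →
    (x + (a₁ + (a₂ + 0ℤ))) + (x + (a₁ + (a₃ + 0ℤ))) - ((x + (a₂ + (a₃ + 0ℤ))) + (x + 0ℤ)) ≡ + 2 * a₁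
  alternatingSum = solve-∀

lemma2p20 : (p q : ℕ) → Prime p → Prime q → p > 3 → q > 3 → p ≢ q →
    (x a₁ a₂ a₃ : ℤ) →
    gcd a₁ (+ p * + q) ≡ + 1 → gcd a₂ (+ p * + q) ≡ + 1 → gcd a₃ (+ p * + q) ≡ + 1 →
    ∃ λ (I : Subset 3) → gcd (x + subsetSum I (a₁ ∷ a₂ ∷ a₃ ∷ [])) (+ p * + q) ≡ + 1
lemma2p20 p q p-prime q-prime p>3 q>3 _ x a₁ a₂ a₃ a₁⊥pq a₂⊥pq a₃⊥pq =
  decidable-stable (anySubset? (λ I → gcd (x + subsetSum I as) (+ p * + q) ≟ + 1)) λ noCoprimeSum →
    [ notOnEvenVertices p-prime p>3 (gcd[i,p*q]≡1⇒p∤i p-prime a₁⊥pq)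
    , notOnEvenVertices q-prime q>3 (gcd[i,p*q]≡1⇒q∤i {p = p} q-prime a₁⊥pq) ]
    (independentCover⇒onEvenVertices
      (divisibleSubsetSums-independent (+ p) x as (gcd[i,p*q]≡1⇒p∤i {q = q} p-prime ∘ as⊥pq))
      (divisibleSubsetSums-independent (+ q) x as (gcd[i,p*q]≡1⇒q∤i {p = p} q-prime ∘ as⊥pq))
      (λ I → gcd[i,p*q]≢1⇒p∣i⊎q∣i p-prime q-prime (λ sᵢ⊥pq → noCoprimeSum (I , sᵢ⊥pq))))
  where
  as : Vec ℤ 3
  as = a₁ ∷ a₂ ∷ a₃ ∷ []

  as⊥pq : ∀ i → gcd (lookup as i) (+ p * + q) ≡ + 1
  as⊥pq zero = a₁⊥pq
  as⊥pq (suc zero) = a₂⊥pq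
  as⊥pq (suc (suc zero)) = a₃⊥pq

  notOnEvenVertices : ∀ {r} → Prime r → r > 3 → ¬ + r ∣ a₁ → ¬ OnEvenVertices (λ I → + r ∣ x + subsetSum I as)
  notOnEvenVertices r-prime r>3 r∤a₁ =
    r∤a₁ ∘ odd-prime∣2*i⇒∣i r-prime (<⇒≤ r>3) ∘ divisibleOnEvenVertices⇒∣2* _ x a₁ a₂ a₃
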